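{- Let $\pi$ be a cohereditary graph property that can be characterized by finitely many obligatory subgraphs, i.e., there is a finite set $\mathcal{S}$ of graphs such that a graph $G$ has $\pi$ if and only if some graph in $\mathcal{S}$ is an induced subgraph of $G$. Then there is an optimal (i.e., $1$-competitive) online algorithm with advice for $\textsc{Min- }\pi$ that reads $O(\log n)$ bits of advice on inputs of length $n$.
   Context: A graph property is cohereditary if whenever a graph $G$ has it and $G$ is an induced subgraph of $G'$, then $G'$ also has it. Online vertex-arrival model: an input is a graph $G$ with vertices $v_1,\dots,v_n$ presented one at a time; when $v_i$ is presented, all edges $\{v_j,v_i\}$ with $j<i$ are revealed; neither $G$ nor $n$ is known in advance. In $\textsc{Min- }\pi$, upon arrival of each vertex the algorithm irrevocably decides whether to accept it; if $S$ is the set of accepted vertices, the cost is $|S|$ if the induced subgraph $G[S]$ has property $\pi$ and $\infty$ otherwise; the goal is to minimize cost. Advice model: the algorithm has access to an infinite binary advice string $\phi$ (chosen with knowledge of the whole input), and its decision at step $i$ may depend on $\phi$ and the vertices seen so far. An algorithm is optimal with advice complexity $b(n)$ if for every $n$ and every input $I$ of length at most $n$ there exists $\phi$ such that its cost on $I$ with advice $\phi$ equals the optimal cost on $I$ and at most the first $b(n)$ bits of $\phi$ are read. -}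

module Defs where

open import Data.Nat using (ℕ; zero; suc; _+_; _*_; _≤_; _<_)
open import Data.Nat.Logarithm using (⌊log₂_⌋)
open import Data.Bool using (Bool; true; false)
open import Data.Fin using (Fin; zero; suc)
open import Data.Maybe using (Maybe; just; nothing)
import Data.Maybe as Maybe
open import Data.Vec using (Vec; []; _∷ʳ_; lookup)
open import Data.List using (List)
open import Data.List.Relation.Unary.Any using (Any)
open import Data.Product using (Σ; Σ-syntax; ∃; ∃-syntax; _×_; _,_)
open import Function.Definitions using (Injective)
open import Function.Bundles using (_⇔_)
open import Relation.Binary.PropositionalEquality using (_≡_)

-- Used both for
--  * the adjacency of a newly presented vertex to the earlier vertices
--    (entry j = is there an edge to v_j), and
--  * the accept/reject decisions of an online algorithm
--    (entry i = was v_i accepted), i.e. subsets of the vertex set.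

infixl 5 _▷_
data Sel : ℕ → Set where
  []  : Sel zero
  _▷_ : ∀ {n} → Sel n → Bool → Sel (suc n)

toVec : ∀ {n} → Sel n → Vec Bool n
toVec []      = []
toVec (s ▷ b) = toVec s ∷ʳ b

size : ∀ {n} → Sel n → ℕ
size []          = zero
size (s ▷ true)  = suc (size s)
size (s ▷ false) = size s

-- Online inputs in the vertex-arrival model: a graph on vertices
-- v_0,…,v_{n-1} presented in order; vertex v_i arrives with its
-- adjacency to v_0,…,v_{i-1}.  Every finite simple graph (with a vertex
-- ordering) is such an object.

infixl 5 _◁_
data Input : ℕ → Set where
  []  : Input zero
  _◁_ : ∀ {n} → Input n → Sel n → Input (suc n)

-- nothing = the last vertex, just k = an earlier vertex k
lastView : ∀ {n} → Fin (suc n) → Maybe (Fin n)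
lastView {zero}  zero    = nothing
lastView {suc n} zero    = just zero
lastView {suc n} (suc i) = Maybe.map suc (lastView i)

-- adjacency (symmetric, irreflexive by construction)
adj : ∀ {n} → Input n → Fin n → Fin n → Bool
adj []      ()
adj (I ◁ v) i j with lastView i | lastView j
... | nothing | nothing = false
... | nothing | just l  = lookup (toVec v) l
... | just k  | nothing = lookup (toVec v) k
... | just k  | just l  = adj I k l

Graph : Set
Graph = Σ ℕ Input

_⊑_ : Graph → Graph → Set
(m , H) ⊑ (n , G) =
  Σ[ f ∈ (Fin m → Fin n) ] Injective _≡_ _≡_ f × (∀ i j → adj H i j ≡ adj G (f i) (f j))

-- induced subgraph G[S], vertices kept in arrival order
restrictSel : ∀ {n} → Sel n → (S : Sel n) → Sel (size S)
restrictSel []      []          = []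
restrictSel (v ▷ b) (S ▷ true)  = restrictSel v S ▷ b
restrictSel (v ▷ b) (S ▷ false) = restrictSel v S

restrict : ∀ {n} → Input n → (S : Sel n) → Input (size S)
restrict []      []          = []
restrict (I ◁ v) (S ▷ true)  = restrict I S ◁ restrictSel v S
restrict (I ◁ v) (S ▷ false) = restrict I S

induced : ∀ {n} → Input n → Sel n → Graph
induced I S = size S , restrict I S

Cohereditary : (Graph → Set) → Set
Cohereditary π = ∀ G G' → G ⊑ G' → π G → π G'

FinitelyCharacterised : (Graph → Set) → Set
FinitelyCharacterised π =
  Σ[ 𝒮 ∈ List Graph ] (∀ G → π G ⇔ Any (λ H → H ⊑ G) 𝒮)

-- The decision on the newest vertex may
-- depend on the (infinite) advice string and on the prefix of the input
-- seen so far (including the current vertex); n is not known.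

Advice : Set
Advice = ℕ → Bool

OnlineAlg : Set
OnlineAlg = Advice → ∀ {n} → Input (suc n) → Bool

run : OnlineAlg → Advice → ∀ {n} → Input n → Sel n
run A φ []      = []
run A φ (I ◁ v) = run A φ I ▷ A φ (I ◁ v)

-- cost(S) ≤ cost(T) in ℕ ∪ {∞}, where cost(S) = |S| if G[S] has π, ∞ otherwise
CostLe : (Graph → Set) → ∀ {n} → Input n → Sel n → Sel n → Set
CostLe π I S T = π (induced I T) → π (induced I S) × size S ≤ size T

OptimalOn : (Graph → Set) → OnlineAlg → Advice → ∀ {n} → Input n → Set
OptimalOn π A φ I = ∀ T → CostLe π I (run A φ I) T

-- on I with advice φ, A reads at most the first b bits of advice:
-- its behaviour is unchanged by altering any advice bit at position ≥ b
ReadsAtMost : OnlineAlg → Advice → ∀ {n} → Input n → ℕ → Set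
ReadsAtMost A φ I b = ∀ (ψ : Advice) → (∀ k → k < b → ψ k ≡ φ k) → run A ψ I ≡ run A φ I

OptimalWithAdvice : (Graph → Set) → OnlineAlg → (ℕ → ℕ) → Set
OptimalWithAdvice π A b =
  ∀ n m → m ≤ n → (I : Input m) →
  Σ[ φ ∈ Advice ] OptimalOn π A φ I × ReadsAtMost A φ I (b n)

IsOLog : (ℕ → ℕ) → Set
IsOLog b = Σ[ c ∈ ℕ ] Σ[ N ∈ ℕ ] (∀ n → N ≤ n → b n ≤ c * ⌊log₂ n ⌋)

module Submission where

-- A cheapest selection S ⊆ V(G) with π(G[S]) can be taken to
-- be the image of an embedding H ⊑ G of a smallest member H of 𝒮 that embeds
-- into G at all; hence |S| ≤ K, where K is the largest order of a graph in 𝒮.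
-- If no member embeds, no induced subgraph has π and the empty selection is
-- optimal.
--
-- The oracle writes S into the advice: with w = 1 + ⌊log₂ n⌋,
-- a header of w pairs (1, decision on vertex r) closed by a 0, followed by at
-- most K entries (1, position in w bits) closed by a 0.  The header is a
-- self-delimiting encoding of w whose decoding for vertex i never needs more
-- than i pairs, so the decoder is structurally terminating; the code has
-- length at most (2K+4)·w = O(log n).  The algorithm ignores the graph and
-- accepts vertex i iff the advice says so.

open import Defs
open import Data.Nat
  using (ℕ; zero; suc; _+_; _*_; _^_; _≤_; _<_; _⊔_; z≤n; s≤s; ⌊_/2⌋; _≤?_; _<?_)
  renaming (_≟_ to _≟ℕ_)
open import Data.Nat.Properties
  using ( ≤-refl; ≤-trans; <-≤-trans; ≤-<-trans; <⇒≤; ≰⇒>; ≮⇒≥; >⇒≢; m≤m⊔n; m≤n⊔m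
        ; m≤n⇒m≤1+n; m<n⇒m<1+n; <⇒≢; 1+n≰n; +-monoʳ-≤
        ; m≤m+n; m≤n+m; +-suc; +-identityʳ; +-monoˡ-≤; *-monoʳ-≤; *-monoˡ-≤
        ; *-cancelˡ-<; *-assoc; module ≤-Reasoning)
open import Data.Nat.Logarithm using (⌊log₂_⌋; ⌊log₂⌋-mono-≤; ⌊log₂[2^n]⌋≡n)
open import Data.Nat.Solver using (module +-*-Solver)
open import Data.Bool using (Bool; true; false; if_then_else_; _∨_)
open import Data.Bool.Properties using () renaming (_≟_ to _≟ᵇ_)
open import Data.Fin using (Fin; zero; suc; fromℕ; inject₁) renaming (_≟_ to _≟ᶠ_)
open import Data.Fin.Properties using (fromℕ≢inject₁; inject₁-injective; any?; all?; injective⇒≤)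
open import Data.Fin.Relation.Unary.Top using (view; ‵fromℕ; ‵inject₁)
open import Data.Maybe using (just; nothing; maybe′)
open import Data.Vec using (Vec; []; _∷_; _∷ʳ_; lookup)
open import Data.List using (List; []; _∷_; _++_; length)
open import Data.Bool.ListAction using (any)
open import Data.List.Properties using (length-++)
open import Data.List.Relation.Unary.All using (All; []; _∷_)
import Data.List.Relation.Unary.All as All
open import Data.List.Relation.Unary.Any using (Any; here; there)
open import Data.List.Membership.Propositional using (_∈_; find; lose)
open import Data.Product using (Σ-syntax; ∃; _×_; _,_; proj₁; proj₂)
open import Data.Sum using (_⊎_; inj₁; inj₂)
open import Data.Empty using (⊥-elim)
open import Data.Unit using (⊤; tt)
open import Function using (_∘_)
open import Function.Bundles using (Equivalence; _⇔_)
open import Function.Definitions using (Injective)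
open import Relation.Nullary using (Dec; yes; no; ¬_; does)
open import Relation.Nullary.Decidable using (map′; _×-dec_; _→-dec_; dec-true; dec-false)
open import Relation.Unary using (Decidable)
open import Relation.Binary.PropositionalEquality

lastView-fromℕ : ∀ n → lastView (fromℕ n) ≡ nothing
lastView-fromℕ zero    = refl
lastView-fromℕ (suc n) rewrite lastView-fromℕ n = refl

lastView-inject₁ : ∀ {n} (k : Fin n) → lastView (inject₁ k) ≡ just k
lastView-inject₁ {suc n} zero    = refl
lastView-inject₁ {suc n} (suc k) rewrite lastView-inject₁ k = refl

lookup-∷ʳ-last : ∀ {A : Set} {n} (xs : Vec A n) (x : A) → lookup (xs ∷ʳ x) (fromℕ n) ≡ x
lookup-∷ʳ-last []       x = refl
lookup-∷ʳ-last (y ∷ xs) x = lookup-∷ʳ-last xs x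

lookup-∷ʳ-inject₁ : ∀ {A : Set} {n} (xs : Vec A n) (x : A) (k : Fin n) →
                    lookup (xs ∷ʳ x) (inject₁ k) ≡ lookup xs k
lookup-∷ʳ-inject₁ (y ∷ xs) x zero    = refl
lookup-∷ʳ-inject₁ (y ∷ xs) x (suc k) = lookup-∷ʳ-inject₁ xs x k

selected : ∀ {n} → Sel n → Fin n → Bool
selected S i = lookup (toVec S) i

module _ {n} (I : Input n) (v : Sel n) where

  adj-new-new : adj (I ◁ v) (fromℕ n) (fromℕ n) ≡ false
  adj-new-new rewrite lastView-fromℕ n = refl

  adj-new-old : ∀ l → adj (I ◁ v) (fromℕ n) (inject₁ l) ≡ selected v l
  adj-new-old l rewrite lastView-fromℕ n | lastView-inject₁ l = refl

  adj-old-new : ∀ k → adj (I ◁ v) (inject₁ k) (fromℕ n) ≡ selected v k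
  adj-old-new k rewrite lastView-fromℕ n | lastView-inject₁ k = refl

  adj-old-old : ∀ k l → adj (I ◁ v) (inject₁ k) (inject₁ l) ≡ adj I k l
  adj-old-old k l rewrite lastView-inject₁ k | lastView-inject₁ l = refl

-- emb T a is the vertex of G that becomes vertex a of G[T].
emb : ∀ {n} (T : Sel n) → Fin (size T) → Fin n
emb (T ▷ true)  a = maybe′ (inject₁ ∘ emb T) (fromℕ _) (lastView a)
emb (T ▷ false) a = inject₁ (emb T a)

emb-new : ∀ {n} (T : Sel n) → emb (T ▷ true) (fromℕ (size T)) ≡ fromℕ n
emb-new T rewrite lastView-fromℕ (size T) = refl

emb-old : ∀ {n} (T : Sel n) k → emb (T ▷ true) (inject₁ k) ≡ inject₁ (emb T k)
emb-old T k rewrite lastView-inject₁ k = refl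

selected-restrictSel : ∀ {n} (v T : Sel n) (a : Fin (size T)) →
                       selected (restrictSel v T) a ≡ selected v (emb T a)
selected-restrictSel (v ▷ b) (T ▷ false) a =
  trans (selected-restrictSel v T a) (sym (lookup-∷ʳ-inject₁ (toVec v) b (emb T a)))
selected-restrictSel (v ▷ b) (T ▷ true) a with view a
... | ‵fromℕ rewrite emb-new T =
  trans (lookup-∷ʳ-last (toVec (restrictSel v T)) b) (sym (lookup-∷ʳ-last (toVec v) b))
... | ‵inject₁ k rewrite emb-old T k =
  trans (lookup-∷ʳ-inject₁ (toVec (restrictSel v T)) b k)
        (trans (selected-restrictSel v T k) (sym (lookup-∷ʳ-inject₁ (toVec v) b (emb T k))))

adj-restrict : ∀ {n} (I : Input n) (T : Sel n) (a b : Fin (size T)) →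
               adj (restrict I T) a b ≡ adj I (emb T a) (emb T b)
adj-restrict (I ◁ v) (T ▷ false) a b =
  trans (adj-restrict I T a b) (sym (adj-old-old I v (emb T a) (emb T b)))
adj-restrict (I ◁ v) (T ▷ true) a b with view a | view b
... | ‵fromℕ | ‵fromℕ rewrite emb-new T =
  trans (adj-new-new (restrict I T) (restrictSel v T)) (sym (adj-new-new I v))
... | ‵fromℕ | ‵inject₁ l rewrite emb-new T | emb-old T l =
  trans (adj-new-old (restrict I T) (restrictSel v T) l)
        (trans (selected-restrictSel v T l) (sym (adj-new-old I v (emb T l))))
... | ‵inject₁ k | ‵fromℕ rewrite emb-new T | emb-old T k =
  trans (adj-old-new (restrict I T) (restrictSel v T) k)
        (trans (selected-restrictSel v T k) (sym (adj-old-new I v (emb T k))))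
... | ‵inject₁ k | ‵inject₁ l rewrite emb-old T k | emb-old T l =
  trans (adj-old-old (restrict I T) (restrictSel v T) k l)
        (trans (adj-restrict I T k l) (sym (adj-old-old I v (emb T k) (emb T l))))

emb-injective : ∀ {n} (T : Sel n) → Injective _≡_ _≡_ (emb T)
emb-injective (T ▷ false) eq = emb-injective T (inject₁-injective eq)
emb-injective (T ▷ true) {a} {b} eq with view a | view b
... | ‵fromℕ | ‵fromℕ = refl
... | ‵fromℕ | ‵inject₁ l rewrite emb-new T | emb-old T l = ⊥-elim (fromℕ≢inject₁ eq)
... | ‵inject₁ k | ‵fromℕ rewrite emb-new T | emb-old T k = ⊥-elim (fromℕ≢inject₁ (sym eq))
... | ‵inject₁ k | ‵inject₁ l rewrite emb-old T k | emb-old T l =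
  cong inject₁ (emb-injective T (inject₁-injective eq))

restrict⊑ : ∀ {n} (I : Input n) (T : Sel n) → induced I T ⊑ (n , I)
restrict⊑ I T = emb T , emb-injective T , adj-restrict I T

emb-selected : ∀ {n} (T : Sel n) (a : Fin (size T)) → selected T (emb T a) ≡ true
emb-selected (T ▷ false) a = trans (lookup-∷ʳ-inject₁ (toVec T) false (emb T a)) (emb-selected T a)
emb-selected (T ▷ true) a with view a
... | ‵fromℕ rewrite emb-new T = lookup-∷ʳ-last (toVec T) true
... | ‵inject₁ k rewrite emb-old T k =
  trans (lookup-∷ʳ-inject₁ (toVec T) true (emb T k)) (emb-selected T k)

emb-onto : ∀ {n} (T : Sel n) (i : Fin n) → selected T i ≡ true → ∃ λ a → emb T a ≡ i
emb-onto (T ▷ b) i sel with view i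
emb-onto (T ▷ false) i sel | ‵fromℕ with trans (sym (lookup-∷ʳ-last (toVec T) false)) sel
... | ()
emb-onto (T ▷ true) i sel | ‵fromℕ = fromℕ (size T) , emb-new T
emb-onto (T ▷ false) i sel | ‵inject₁ k
  with emb-onto T k (trans (sym (lookup-∷ʳ-inject₁ (toVec T) false k)) sel)
... | a , ea = a , cong inject₁ ea
emb-onto (T ▷ true) i sel | ‵inject₁ k
  with emb-onto T k (trans (sym (lookup-∷ʳ-inject₁ (toVec T) true k)) sel)
... | a , ea = inject₁ a , trans (emb-old T a) (cong inject₁ ea)

tabulate : ∀ {n} → (Fin n → Bool) → Sel n
tabulate {zero}  g = []
tabulate {suc n} g = tabulate (g ∘ inject₁) ▷ g (fromℕ n)

selected-tabulate : ∀ {n} (g : Fin n → Bool) i → selected (tabulate g) i ≡ g i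
selected-tabulate {suc n} g i with view i
... | ‵fromℕ = lookup-∷ʳ-last (toVec (tabulate (g ∘ inject₁))) (g (fromℕ n))
... | ‵inject₁ k = trans (lookup-∷ʳ-inject₁ (toVec (tabulate (g ∘ inject₁))) (g (fromℕ n)) k)
                         (selected-tabulate (g ∘ inject₁) k)

-- An embedding H ⊑ G yields a selection S, its image, with H ⊑ G[S] and
-- |S| ≤ |H|: the embedding factors through emb S, and the inverse map
-- Fin |S| → Fin |H| is injective.
image : ∀ {m n} (H : Input m) (G : Input n) → (m , H) ⊑ (n , G) →
        Σ[ S ∈ Sel n ] (m , H) ⊑ induced G S × size S ≤ m
image {m} {n} H G (f , f-inj , f-adj) = S , (h , h-inj , h-adj) , injective⇒≤ p-inj
  where
  inImage? : ∀ i → Dec (∃ λ x → f x ≡ i)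
  inImage? i = any? (λ x → f x ≟ᶠ i)

  S : Sel n
  S = tabulate (does ∘ inImage?)

  -- every f x is selected, so it has a preimage h x under emb S
  hit : ∀ x → ∃ λ a → emb S a ≡ f x
  hit x = emb-onto S (f x) (trans (selected-tabulate _ (f x)) (dec-true (inImage? (f x)) (x , refl)))

  h : Fin m → Fin (size S)
  h = proj₁ ∘ hit

  h-inj : Injective _≡_ _≡_ h
  h-inj {x} {y} eq = f-inj (trans (sym (proj₂ (hit x))) (trans (cong (emb S) eq) (proj₂ (hit y))))

  h-adj : ∀ i j → adj H i j ≡ adj (restrict G S) (h i) (h j)
  h-adj i j = trans (f-adj i j)
    (sym (trans (adj-restrict G S (h i) (h j)) (cong₂ (adj G) (proj₂ (hit i)) (proj₂ (hit j)))))

  preimage : ∀ a → ∃ λ x → f x ≡ emb S a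
  preimage a with inImage? (emb S a) | trans (sym (selected-tabulate _ (emb S a))) (emb-selected S a)
  ... | yes pre | _  = pre
  ... | no _    | ()

  p-inj : Injective _≡_ _≡_ (proj₁ ∘ preimage)
  p-inj {a} {b} eq =
    emb-injective S (trans (sym (proj₂ (preimage a))) (trans (cong f eq) (proj₂ (preimage b))))

-- Existence of a map Fin m → Fin n with a decidable, pointwise-invariant
-- property is decidable: choose the image of zero, then recurse.
searchMaps : ∀ m {n} (P : (Fin m → Fin n) → Set) →
             (∀ {f g} → (∀ i → f i ≡ g i) → P f → P g) →
             (∀ f → Dec (P f)) → Dec (∃ P)
searchMaps zero P resp P? = map′ (λ p → _ , p) (λ { (f , p) → resp (λ ()) p }) (P? (λ ()))
searchMaps (suc m) {n} P resp P? = map′ extend restrictMap (any? λ x → searchMaps m (P ∘ cons x)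
  (λ eq → resp λ { zero → refl ; (suc i) → eq i }) (P? ∘ cons x))
  where
  cons : Fin n → (Fin m → Fin n) → Fin (suc m) → Fin n
  cons x g zero    = x
  cons x g (suc i) = g i

  extend : (∃ λ x → ∃ λ g → P (cons x g)) → ∃ P
  extend (x , g , p) = cons x g , p

  restrictMap : ∃ P → ∃ λ x → ∃ λ g → P (cons x g)
  restrictMap (f , p) = f zero , f ∘ suc , resp (λ { zero → refl ; (suc i) → refl }) p

IsEmbedding : ∀ {m n} → Input m → Input n → (Fin m → Fin n) → Set
IsEmbedding H G f = (∀ i j → f i ≡ f j → i ≡ j) × (∀ i j → adj H i j ≡ adj G (f i) (f j))

_⊑?_ : (H G : Graph) → Dec (H ⊑ G)
(m , H) ⊑? (n , G) =
  map′ (λ { (f , inj , ad) → f , (λ {i} {j} → inj i j) , ad })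
       (λ { (f , inj , ad) → f , (λ i j → inj {i} {j}) , ad })
       (searchMaps m (IsEmbedding H G) isEmbedding-resp isEmbedding?)
  where
  isEmbedding-resp : ∀ {f g} → (∀ i → f i ≡ g i) → IsEmbedding H G f → IsEmbedding H G g
  isEmbedding-resp {f} {g} f≗g (inj , ad) =
    (λ i j eq → inj i j (trans (f≗g i) (trans eq (sym (f≗g j))))) ,
    (λ i j → trans (ad i j) (cong₂ (adj G) (f≗g i) (f≗g j)))

  isEmbedding? : ∀ f → Dec (IsEmbedding H G f)
  isEmbedding? f = all? (λ i → all? λ j → (f i ≟ᶠ f j) →-dec (i ≟ᶠ j))
             ×-dec all? (λ i → all? λ j → adj H i j ≟ᵇ adj G (f i) (f j))

order : Graph → ℕ
order = proj₁

⊑⇒order≤ : ∀ {A B} → A ⊑ B → order A ≤ order B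
⊑⇒order≤ (f , f-inj , _) = injective⇒≤ f-inj

⊑-trans : ∀ {A B C} → A ⊑ B → B ⊑ C → A ⊑ C
⊑-trans (f , f-inj , f-adj) (g , g-inj , g-adj) =
  g ∘ f , f-inj ∘ g-inj , λ i j → trans (f-adj i j) (g-adj (f i) (f j))

least : ∀ {A : Set} {P : A → Set} (μ : A → ℕ) → Decidable P → (xs : List A) →
        (Σ[ x ∈ A ] x ∈ xs × P x × (∀ {y} → y ∈ xs → P y → μ x ≤ μ y))
        ⊎ (∀ {y} → y ∈ xs → ¬ P y)
least μ P? [] = inj₂ λ ()
least μ P? (x ∷ xs) with P? x | least μ P? xs
... | no ¬px | inj₂ none = inj₂ λ { (here refl) → ¬px ; (there y∈) → none y∈ }
... | no ¬px | inj₁ (y , y∈ , py , min) =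
  inj₁ (y , there y∈ , py , λ { (here refl) pz → ⊥-elim (¬px pz) ; (there z∈) → min z∈ })
... | yes px | inj₂ none =
  inj₁ (x , here refl , px , λ { (here refl) _ → ≤-refl ; (there z∈) pz → ⊥-elim (none z∈ pz) })
... | yes px | inj₁ (y , y∈ , py , min) with μ x ≤? μ y
...   | yes μx≤μy = inj₁ (x , here refl , px ,
          λ { (here refl) _ → ≤-refl ; (there z∈) pz → ≤-trans μx≤μy (min z∈ pz) })
...   | no μx≰μy = inj₁ (y , there y∈ , py ,
          λ { (here refl) _ → <⇒≤ (≰⇒> μx≰μy) ; (there z∈) → min z∈ })

maxOrder : List Graph → ℕ
maxOrder []      = 0
maxOrder (H ∷ 𝒮) = order H ⊔ maxOrder 𝒮

order≤maxOrder : ∀ {H} (𝒮 : List Graph) → H ∈ 𝒮 → order H ≤ maxOrder 𝒮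
order≤maxOrder (X ∷ 𝒮) (here refl) = m≤m⊔n (order X) (maxOrder 𝒮)
order≤maxOrder (X ∷ 𝒮) (there H∈) = ≤-trans (order≤maxOrder 𝒮 H∈) (m≤n⊔m (order X) (maxOrder 𝒮))

emptySel : ∀ n → Sel n
emptySel zero    = []
emptySel (suc n) = emptySel n ▷ false

size-emptySel : ∀ n → size (emptySel n) ≡ 0
size-emptySel zero    = refl
size-emptySel (suc n) = size-emptySel n

obligatoryWitness : (π : Graph → Set) (𝒮 : List Graph) → (∀ G → π G ⇔ Any (_⊑ G) 𝒮) →
  ∀ {m} (I : Input m) (T : Sel m) → π (induced I T) →
  Σ[ X ∈ Graph ] X ∈ 𝒮 × X ⊑ (m , I) × order X ≤ size T
obligatoryWitness π 𝒮 π⇔ {m} I T πT with find (Equivalence.to (π⇔ (induced I T)) πT)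
... | X , X∈ , X⊑T = X , X∈ , ⊑-trans {X} {induced I T} {m , I} X⊑T (restrict⊑ I T)
                   , ⊑⇒order≤ {X} {induced I T} X⊑T

-- Every input has an optimal selection of size at most maxOrder 𝒮: the
-- image of a smallest member of 𝒮 embeddable into G, or ∅ if there is none.
optimalSelection : (π : Graph → Set) (𝒮 : List Graph) → (∀ G → π G ⇔ Any (_⊑ G) 𝒮) →
  ∀ {m} (I : Input m) → Σ[ S ∈ Sel m ] size S ≤ maxOrder 𝒮 × (∀ T → CostLe π I S T)
optimalSelection π 𝒮 π⇔ {m} I with least order (_⊑? (m , I)) 𝒮
... | inj₂ none = emptySel m , subst (_≤ maxOrder 𝒮) (sym (size-emptySel m)) z≤n ,
      λ T πT → let (X , X∈ , X⊑I , _) = obligatoryWitness π 𝒮 π⇔ I T πT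
               in ⊥-elim (none X∈ X⊑I)
... | inj₁ ((k , H) , H∈ , H⊑I , smallest) with image H I H⊑I
... | S , H⊑S , |S|≤k = S , ≤-trans |S|≤k (order≤maxOrder 𝒮 H∈) ,
      λ T πT → let (X , X∈ , X⊑I , |X|≤|T|) = obligatoryWitness π 𝒮 π⇔ I T πT
               in Equivalence.from (π⇔ _) (lose H∈ H⊑S) ,
                  ≤-trans |S|≤k (≤-trans (smallest X∈ X⊑I) |X|≤|T|)

_↓_ : Advice → ℕ → Advice
(ψ ↓ s) k = ψ (s + k)

Extends : Advice → List Bool → Set
Extends ψ []       = ⊤
Extends ψ (b ∷ bs) = ψ 0 ≡ b × Extends (ψ ↓ 1) bs

pad : List Bool → Advice
pad []       k       = false
pad (b ∷ bs) zero    = b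
pad (b ∷ bs) (suc k) = pad bs k

pad-extends : ∀ xs → Extends (pad xs) xs
pad-extends []       = tt
pad-extends (b ∷ bs) = refl , pad-extends bs

extends-prefix : ∀ xs {ψ φ} → (∀ k → k < length xs → ψ k ≡ φ k) → Extends φ xs → Extends ψ xs
extends-prefix []       agree _          = tt
extends-prefix (b ∷ bs) agree (φ₀ , ext) =
  trans (agree 0 (s≤s z≤n)) φ₀ , extends-prefix bs (λ k k< → agree (suc k) (s≤s k<)) ext

odd? : ℕ → Bool
odd? zero          = false
odd? (suc zero)    = true
odd? (suc (suc n)) = odd? n

bit : Bool → ℕ
bit false = 0
bit true  = 1

bit-odd?+2*half : ∀ p → bit (odd? p) + 2 * ⌊ p /2⌋ ≡ p
bit-odd?+2*half zero          = refl
bit-odd?+2*half (suc zero)    = refl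
bit-odd?+2*half (suc (suc p)) = trans (unfold (bit (odd? p)) ⌊ p /2⌋) (cong (2 +_) (bit-odd?+2*half p))
  where
  open +-*-Solver
  unfold : ∀ b h → b + 2 * suc h ≡ 2 + (b + 2 * h)
  unfold = solve 2 (λ b h → b :+ con 2 :* (con 1 :+ h) := con 2 :+ (b :+ con 2 :* h)) refl

half-< : ∀ p k → p < 2 * k → ⌊ p /2⌋ < k
half-< p k p<2k = *-cancelˡ-< 2 ⌊ p /2⌋ k
  (≤-<-trans (m≤n+m (2 * ⌊ p /2⌋) (bit (odd? p))) (subst (_< 2 * k) (sym (bit-odd?+2*half p)) p<2k))

-- the w-bit representation of p, least significant bit first
bits : ℕ → ℕ → List Bool
bits zero    p = []
bits (suc w) p = odd? p ∷ bits w ⌊ p /2⌋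

length-bits : ∀ w p → length (bits w p) ≡ w
length-bits zero    p = refl
length-bits (suc w) p = cong suc (length-bits w ⌊ p /2⌋)

readNat : ℕ → Advice → ℕ
readNat zero    ψ = 0
readNat (suc w) ψ = bit (ψ 0) + 2 * readNat w (ψ ↓ 1)

readNat-bits : ∀ w {p ψ} rest → p < 2 ^ w → Extends ψ (bits w p ++ rest) →
               readNat w ψ ≡ p × Extends (ψ ↓ w) rest
readNat-bits zero    {zero}  rest _         ext = refl , ext
readNat-bits zero    {suc p} rest (s≤s ()) _
readNat-bits (suc w) {p} rest p<2^w (ψ₀ , ext) with readNat-bits w rest (half-< p (2 ^ w) p<2^w) ext
... | read , ext′ =
  trans (cong₂ (λ b h → bit b + 2 * h) ψ₀ read) (bit-odd?+2*half p) , ext′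

positionsCode : ℕ → List ℕ → List Bool
positionsCode w []       = false ∷ []
positionsCode w (p ∷ ps) = true ∷ bits w p ++ positionsCode w ps

occurs : ℕ → List ℕ → Bool
occurs i = any (λ p → does (p ≟ℕ i))

listed : (w K i : ℕ) → Advice → Bool
listed w zero    i ψ = false
listed w (suc K) i ψ =
  if ψ 0 then does (readNat w (ψ ↓ 1) ≟ℕ i) ∨ listed w K i (ψ ↓ suc w) else false

listed-correct : ∀ w K i ps {ψ} → length ps ≤ K → All (_< 2 ^ w) ps →
                 Extends ψ (positionsCode w ps) → listed w K i ψ ≡ occurs i ps
listed-correct w zero    i []       _ _ _ = refl
listed-correct w (suc K) i []       _ _ (ψ₀ , _) rewrite ψ₀ = refl
listed-correct w (suc K) i (p ∷ ps) (s≤s len) (p< ∷ ps<) (ψ₀ , ext)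
  with readNat-bits w (positionsCode w ps) p< ext
... | read , ext′ rewrite ψ₀ | read = cong (does (p ≟ℕ i) ∨_) (listed-correct w K i ps len ps< ext′)

-- A header of c pairs (1, d r), closed by a 0: a self-delimiting encoding
-- of c that also carries the decisions d on the first c vertices.
header : ℕ → (ℕ → Bool) → List Bool
header zero    d = false ∷ []
header (suc c) d = true ∷ d 0 ∷ header c (d ∘ suc)

-- Decision on vertex i, with r header pairs still to skip before the pair
-- of i and a pairs already skipped; past the header the width is known and
-- the listed positions are searched.  Recursion on r bounds the reading.
scan : (K i r a : ℕ) → Advice → Bool
scan K i zero    a ψ = if ψ 0 then ψ 1 else listed a K i (ψ ↓ 1)
scan K i (suc r) a ψ = if ψ 0 then scan K i r (suc a) (ψ ↓ 2) else listed a K i (ψ ↓ 1)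

decide : ℕ → Advice → ℕ → Bool
decide K ψ i = scan K i i 0 ψ

scan-header : ∀ c d rest {K i r a ψ} → Extends ψ (header c d ++ rest) → r < c →
              scan K i r a ψ ≡ d r
scan-header (suc c) d rest {r = zero}  (ψ₀ , ψ₁ , _)   _         rewrite ψ₀ = ψ₁
scan-header (suc c) d rest {r = suc r} (ψ₀ , _ , ext) (s≤s r<c) rewrite ψ₀ =
  scan-header c (d ∘ suc) rest ext r<c

scan-past-header : ∀ c d rest {K i r a ψ} → Extends ψ (header c d ++ rest) → c ≤ r →
                   ∃ λ ψ′ → Extends ψ′ rest × scan K i r a ψ ≡ listed (c + a) K i ψ′
scan-past-header zero    d rest {r = zero}  (ψ₀ , ext) _ rewrite ψ₀ = _ , ext , refl
scan-past-header zero    d rest {r = suc r} (ψ₀ , ext) _ rewrite ψ₀ = _ , ext , refl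
scan-past-header (suc c) d rest {K} {i} {suc r} {a} (ψ₀ , _ , ext) (s≤s c≤r) rewrite ψ₀
  with scan-past-header c (d ∘ suc) rest {K} {i} {r} {suc a} ext c≤r
... | ψ′ , ext′ , eq = ψ′ , ext′ , trans eq (cong (λ w → listed w K i ψ′) (+-suc c a))

length-header : ∀ c d → length (header c d) ≡ suc (c + c)
length-header zero    d = refl
length-header (suc c) d = cong (2 +_) (trans (length-header c (d ∘ suc)) (sym (+-suc c c)))

length-positionsCode : ∀ w ps → length (positionsCode w ps) ≡ suc (length ps * suc w)
length-positionsCode w []       = refl
length-positionsCode w (p ∷ ps) = cong suc (begin
  length (bits w p ++ positionsCode w ps)          ≡⟨ length-++ (bits w p) ⟩
  length (bits w p) + length (positionsCode w ps)  ≡⟨ cong₂ _+_ (length-bits w p) (length-positionsCode w ps) ⟩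
  w + suc (length ps * suc w)                      ≡⟨ +-suc w _ ⟩
  suc (w + length ps * suc w)                      ∎)
  where open ≡-Reasoning

-- whether vertex i (counted from 0) is selected; false beyond the end
member : ∀ {n} → Sel n → ℕ → Bool
member []              i = false
member {suc n} (S ▷ b) i = if does (n ≟ℕ i) then b else member S i

member-new : ∀ {n} (S : Sel n) b → member (S ▷ b) n ≡ b
member-new {n} S b rewrite dec-true (n ≟ℕ n) refl = refl

member-old : ∀ {n i} (S : Sel n) b → i < n → member (S ▷ b) i ≡ member S i
member-old {n} {i} S b i<n rewrite dec-false (n ≟ℕ i) (>⇒≢ i<n) = refl

positions : ∀ {n} → Sel n → List ℕ
positions []              = []
positions {suc n} (S ▷ true)  = n ∷ positions S
positions         (S ▷ false) = positions S

positions-below : ∀ {n} (S : Sel n) → All (_< n) (positions S)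
positions-below []          = []
positions-below (S ▷ true)  = ≤-refl ∷ All.map m≤n⇒m≤1+n (positions-below S)
positions-below (S ▷ false) = All.map m≤n⇒m≤1+n (positions-below S)

length-positions : ∀ {n} (S : Sel n) → length (positions S) ≤ size S
length-positions []          = z≤n
length-positions (S ▷ true)  = s≤s (length-positions S)
length-positions (S ▷ false) = length-positions S

occurs-below : ∀ {i} ps → All (_< i) ps → occurs i ps ≡ false
occurs-below         []       []           = refl
occurs-below {i} (p ∷ ps) (p<i ∷ ps<i) rewrite dec-false (p ≟ℕ i) (<⇒≢ p<i) = occurs-below ps ps<i

occurs-positions : ∀ {n} (S : Sel n) i → occurs i (positions S) ≡ member S i
occurs-positions [] i = refl
occurs-positions {suc n} (S ▷ true) i with n ≟ℕ i
... | yes refl rewrite dec-true (n ≟ℕ n) refl = refl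
... | no n≢i    rewrite dec-false (n ≟ℕ i) n≢i = occurs-positions S i
occurs-positions {suc n} (S ▷ false) i with n ≟ℕ i
... | yes refl rewrite dec-true (n ≟ℕ n) refl = occurs-below (positions S) (positions-below S)
... | no n≢i    rewrite dec-false (n ≟ℕ i) n≢i = occurs-positions S i

width : ℕ → ℕ
width n = suc ⌊log₂ n ⌋

n<2^width : ∀ n → n < 2 ^ width n
n<2^width n = ≰⇒> λ 2^w≤n →
  1+n≰n (subst (_≤ ⌊log₂ n ⌋) (⌊log₂[2^n]⌋≡n (width n)) (⌊log₂⌋-mono-≤ 2^w≤n))

width≤2*log : ∀ {n} → 2 ≤ n → width n ≤ 2 * ⌊log₂ n ⌋
width≤2*log {n} 2≤n =
  subst (suc L ≤_) (cong (L +_) (sym (+-identityʳ L))) (+-monoˡ-≤ L (⌊log₂⌋-mono-≤ 2≤n))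
  where
  L : ℕ
  L = ⌊log₂ n ⌋

oblivious : (Advice → ℕ → Bool) → OnlineAlg
oblivious δ ψ {n} _ = δ ψ n

run-oblivious : ∀ δ ψ {m} (I : Input m) (S : Sel m) →
                (∀ i → i < m → δ ψ i ≡ member S i) → run (oblivious δ) ψ I ≡ S
run-oblivious δ ψ []              []      _     = refl
run-oblivious δ ψ {suc m} (I ◁ v) (S ▷ b) agree = cong₂ _▷_
  (run-oblivious δ ψ I S λ i i<m → trans (agree i (m<n⇒m<1+n i<m)) (member-old S b i<m))
  (trans (agree m ≤-refl) (member-new S b))

adviceCode : ∀ {m} → ℕ → Sel m → List Bool
adviceCode n S = header (width n) (member S) ++ positionsCode (width n) (positions S)

decide-correct : ∀ K n {m} (S : Sel m) {ψ} → size S ≤ K → m ≤ n →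
                 Extends ψ (adviceCode n S) → ∀ i → decide K ψ i ≡ member S i
decide-correct K n S {ψ} |S|≤K m≤n ext i with i <? width n
... | yes i<w = scan-header (width n) (member S) _ ext i<w
... | no  i≮w with scan-past-header (width n) (member S) _ {K} {i} ext (≮⇒≥ i≮w)
... | ψ′ , ext′ , eq = begin
  decide K ψ i                ≡⟨ eq ⟩
  listed (width n + 0) K i ψ′ ≡⟨ cong (λ w → listed w K i ψ′) (+-identityʳ (width n)) ⟩
  listed (width n) K i ψ′     ≡⟨ listed-correct (width n) K i (positions S)
                                   (≤-trans (length-positions S) |S|≤K) positions<2^w ext′ ⟩
  occurs i (positions S)      ≡⟨ occurs-positions S i ⟩
  member S i                  ∎
  where
  open ≡-Reasoning
  positions<2^w : All (_< 2 ^ width n) (positions S)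
  positions<2^w = All.map (λ p<m → <-≤-trans (<-≤-trans p<m m≤n) (<⇒≤ (n<2^width n))) (positions-below S)

adviceBound : ℕ → ℕ → ℕ
adviceBound K n = (2 * K + 4) * width n

length-adviceCode : ∀ K n {m} (S : Sel m) → size S ≤ K → length (adviceCode n S) ≤ adviceBound K n
length-adviceCode K n S |S|≤K = begin
  length (adviceCode n S)                                    ≡⟨ length-++ (header w (member S)) ⟩
  length (header w (member S)) + length (positionsCode w ps) ≡⟨ cong₂ _+_ (length-header w (member S))
                                                                          (length-positionsCode w ps) ⟩
  suc (w + w) + suc (length ps * suc w)                      ≤⟨ +-monoʳ-≤ (suc (w + w)) (s≤s
                                                                  (*-monoˡ-≤ (suc w) (≤-trans (length-positions S) |S|≤K))) ⟩
  suc (w + w) + suc (K * suc w)                              ≤⟨ m≤m+n _ (K * L + 2 * L) ⟩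
  suc (w + w) + suc (K * suc w) + (K * L + 2 * L)            ≡⟨ rearrange K L ⟩
  adviceBound K n                                            ∎
  where
  open ≤-Reasoning
  open +-*-Solver
  w : ℕ
  w = width n
  L : ℕ
  L = ⌊log₂ n ⌋
  ps : List ℕ
  ps = positions S
  rearrange : ∀ K L → suc (suc L + suc L) + suc (K * suc (suc L)) + (K * L + 2 * L)
                     ≡ (2 * K + 4) * suc L
  rearrange = solve 2 (λ K L → (con 1 :+ ((con 1 :+ L) :+ (con 1 :+ L))) :+ (con 1 :+ K :* (con 2 :+ L))
                               :+ (K :* L :+ con 2 :* L) := (con 2 :* K :+ con 4) :* (con 1 :+ L)) refl

adviceBound-log : ∀ K → IsOLog (adviceBound K)
adviceBound-log K = (2 * K + 4) * 2 , 2 , λ n 2≤n → begin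
  (2 * K + 4) * width n          ≤⟨ *-monoʳ-≤ (2 * K + 4) (width≤2*log 2≤n) ⟩
  (2 * K + 4) * (2 * ⌊log₂ n ⌋)  ≡⟨ *-assoc (2 * K + 4) 2 ⌊log₂ n ⌋ ⟨
  (2 * K + 4) * 2 * ⌊log₂ n ⌋    ∎
  where open ≤-Reasoning

algorithm : ℕ → OnlineAlg
algorithm K = oblivious (decide K)

accepts : ∀ K n {m} (S : Sel m) (I : Input m) → size S ≤ K → m ≤ n → (ψ : Advice) →
          (∀ k → k < adviceBound K n → ψ k ≡ pad (adviceCode n S) k) → run (algorithm K) ψ I ≡ S
accepts K n S I |S|≤K m≤n ψ agree = run-oblivious (decide K) ψ I S λ i _ →
  decide-correct K n S |S|≤K m≤n
    (extends-prefix (adviceCode n S)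
      (λ k k< → agree k (<-≤-trans k< (length-adviceCode K n S |S|≤K)))
      (pad-extends (adviceCode n S))) i

-- Theorem 12.

theorem12 : (π : Graph → Set) → Cohereditary π → FinitelyCharacterised π →
            Σ[ A ∈ OnlineAlg ] Σ[ b ∈ (ℕ → ℕ) ] IsOLog b × OptimalWithAdvice π A b
theorem12 π _ (𝒮 , π⇔) = algorithm K , adviceBound K , adviceBound-log K , optimal
  where
  K : ℕ
  K = maxOrder 𝒮

  optimal : OptimalWithAdvice π (algorithm K) (adviceBound K)
  optimal n m m≤n I with optimalSelection π 𝒮 π⇔ I
  ... | S , |S|≤K , S-optimal = φ , subst (λ X → ∀ T → CostLe π I X T) (sym runsφ) S-optimal
                              , λ ψ agree → trans (runs ψ agree) (sym runsφ)
    where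
    φ : Advice
    φ = pad (adviceCode n S)

    runs : ∀ ψ → (∀ k → k < adviceBound K n → ψ k ≡ φ k) → run (algorithm K) ψ I ≡ S
    runs = accepts K n S I |S|≤K m≤n

    runsφ : run (algorithm K) φ I ≡ S
    runsφ = runs φ (λ _ _ → refl)
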